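{- Let $P:=(\iota\Rightarrow\iota)\Rightarrow\iota$. For every dialogue tree $d\in\mathcal{D}_{\mathbb N}\mathbb{N}$ and every sequence $\alpha:\mathbb{N}\to\mathbb{N}$, we have $\mathsf{dialogue}\,d\,\alpha=[\![\mathsf{dial}^T]\!]\,(\mathsf{enc}_{P}\,d)\,\alpha$.
   Context: Metatheory: constructive Martin-Löf type theory without function extensionality. System T types: base $\iota$ and $\sigma\Rightarrow\tau$; standard terms and set interpretation $[\![\iota]\!]=\mathbb{N}$, $[\![\sigma\Rightarrow\tau]\!]=[\![\sigma]\!]\to[\![\tau]\!]$. Dialogue trees $\mathcal{D}_{\mathbb N}\mathbb{N}$: inductive, constructors $\eta\,n$ and $\beta\,\varphi\,i$ ($\varphi:\mathbb{N}\to\mathcal{D}_{\mathbb N}\mathbb{N}$, $i\in\mathbb{N}$). $\mathsf{dialogue}(\eta\,x)\,\alpha=x$, $\mathsf{dialogue}(\beta\,\varphi\,i)\,\alpha=\mathsf{dialogue}(\varphi(\alpha\,i))\,\alpha$. Internal trees: $\mathsf{ChD}_A(\sigma):=(\sigma\Rightarrow A)\Rightarrow((\iota\Rightarrow A)\Rightarrow\iota\Rightarrow A)\Rightarrow A$; $\eta_A:=\lambda z\,e\,b.\,e\,z$; $\beta_A:=\lambda\varphi\,x\,e\,b.\,b(\lambda y.\varphi\,y\,e\,b)\,x$. Encoding $\mathsf{enc}_A:\mathcal{D}_{\mathbb N}\mathbb{N}\to[\![\mathsf{ChD}_A(\iota)]\!]$: $\mathsf{enc}_A(\eta\,z)=[\![\eta_A]\!]z$,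 $\mathsf{enc}_A(\beta\,\varphi\,x)=[\![\beta_A]\!](\mathsf{enc}_A\circ\varphi)\,x$. Internal dialogue operator: $\mathsf{dial}^T:=\lambda d.\,d\,(\lambda z\,w.\,z)\,(\lambda\varphi\,x\,\alpha.\,\varphi\,(\alpha\,x)\,\alpha)$, a closed term of type $\mathsf{ChD}_P(\iota)\Rightarrow P$. -}

module Defs where

open import Data.Nat using (ℕ; zero; suc)
open import Data.List using (List; []; _∷_)

infixr 5 _⇒_
data Ty : Set where
  ι   : Ty
  _⇒_ : Ty → Ty → Ty

Cx : Set
Cx = List Ty

data _∋_ : Cx → Ty → Set where
  here  : ∀ {Γ σ} → (σ ∷ Γ) ∋ σ
  there : ∀ {Γ σ τ} → Γ ∋ σ → (τ ∷ Γ) ∋ σ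

data Tm (Γ : Cx) : Ty → Set where
  Zero : Tm Γ ι
  Succ : Tm Γ (ι ⇒ ι)
  Rec  : ∀ {σ} → Tm Γ ((ι ⇒ σ ⇒ σ) ⇒ σ ⇒ ι ⇒ σ)
  ν    : ∀ {σ} → Γ ∋ σ → Tm Γ σ
  ƛ    : ∀ {σ τ} → Tm (σ ∷ Γ) τ → Tm Γ (σ ⇒ τ)
  _·_  : ∀ {σ τ} → Tm Γ (σ ⇒ τ) → Tm Γ σ → Tm Γ τ
infixl 6 _·_

⟦_⟧ᵀ : Ty → Set
⟦ ι ⟧ᵀ     = ℕ
⟦ σ ⇒ τ ⟧ᵀ = ⟦ σ ⟧ᵀ → ⟦ τ ⟧ᵀ

data Env : Cx → Set where
  []  : Env []
  _∷_ : ∀ {Γ σ} → ⟦ σ ⟧ᵀ → Env Γ → Env (σ ∷ Γ)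

lookupEnv : ∀ {Γ σ} → Env Γ → Γ ∋ σ → ⟦ σ ⟧ᵀ
lookupEnv (x ∷ _) here      = x
lookupEnv (_ ∷ ρ) (there i) = lookupEnv ρ i

rec : ∀ {A : Set} → (ℕ → A → A) → A → ℕ → A
rec f a zero    = a
rec f a (suc n) = f n (rec f a n)

⟦_⟧ₑ : ∀ {Γ σ} → Tm Γ σ → Env Γ → ⟦ σ ⟧ᵀ
⟦ Zero ⟧ₑ ρ  = zero
⟦ Succ ⟧ₑ ρ  = suc
⟦ Rec ⟧ₑ ρ   = rec
⟦ ν i ⟧ₑ ρ   = lookupEnv ρ i
⟦ ƛ t ⟧ₑ ρ   = λ x → ⟦ t ⟧ₑ (x ∷ ρ)
⟦ t · u ⟧ₑ ρ = ⟦ t ⟧ₑ ρ (⟦ u ⟧ₑ ρ)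

⟦_⟧ : ∀ {σ} → Tm [] σ → ⟦ σ ⟧ᵀ
⟦ t ⟧ = ⟦ t ⟧ₑ []

data D : Set where
  η : ℕ → D
  β : (ℕ → D) → ℕ → D

dialogue : D → (ℕ → ℕ) → ℕ
dialogue (η x)   α = x
dialogue (β φ i) α = dialogue (φ (α i)) α

-- internal (Church-encoded) trees
ChD : Ty → Ty → Ty
ChD A σ = (σ ⇒ A) ⇒ ((ι ⇒ A) ⇒ ι ⇒ A) ⇒ A

private
  v0 : ∀ {Γ σ} → Tm (σ ∷ Γ) σ
  v0 = ν here
  v1 : ∀ {Γ σ τ} → Tm (τ ∷ σ ∷ Γ) σ
  v1 = ν (there here)
  v2 : ∀ {Γ σ τ ρ} → Tm (ρ ∷ τ ∷ σ ∷ Γ) σ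
  v2 = ν (there (there here))
  v3 : ∀ {Γ σ τ ρ κ} → Tm (κ ∷ ρ ∷ τ ∷ σ ∷ Γ) σ
  v3 = ν (there (there (there here)))
  v4 : ∀ {Γ σ τ ρ κ μ} → Tm (μ ∷ κ ∷ ρ ∷ τ ∷ σ ∷ Γ) σ
  v4 = ν (there (there (there (there here))))

-- η_A := λ z e b. e z
ηᵀ : ∀ {Γ} (A : Ty) → Tm Γ (ι ⇒ ChD A ι)
ηᵀ A = ƛ (ƛ (ƛ (v1 · v2)))

-- β_A := λ φ x e b. b (λ y. φ y e b) x
βᵀ : ∀ {Γ} (A : Ty) → Tm Γ ((ι ⇒ ChD A ι) ⇒ ι ⇒ ChD A ι)
βᵀ A = ƛ (ƛ (ƛ (ƛ (v0 · ƛ (v4 · v0 · v2 · v1) · v2))))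

enc : (A : Ty) → D → ⟦ ChD A ι ⟧ᵀ
enc A (η z)   = ⟦ ηᵀ A ⟧ z
enc A (β φ x) = ⟦ βᵀ A ⟧ (λ y → enc A (φ y)) x

P : Ty
P = (ι ⇒ ι) ⇒ ι

-- dial^T := λ d. d (λ z w. z) (λ φ x α. φ (α x) α)
dialᵀ : Tm [] (ChD P ι ⇒ P)
dialᵀ = ƛ (v0 · ƛ (ƛ v1) · ƛ (ƛ (ƛ (v2 · (v0 · v1) · v0))))

module Submission where

open import Defs
open import Relation.Binary.PropositionalEquality using (_≡_; refl)
open import Data.Nat using (ℕ)

-- Both sides compute: ⟦ dialᵀ ⟧ (enc P (β φ i)) α reduces definitionally to
-- ⟦ dialᵀ ⟧ (enc P (φ (α i))) α, so each case is the induction hypothesis on the chosen subtree.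
lemma36 : (d : D) (α : ℕ → ℕ) → dialogue d α ≡ ⟦ dialᵀ ⟧ (enc P d) α
lemma36 (η x)   α = refl
lemma36 (β φ i) α = lemma36 (φ (α i)) α
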